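{- Let $G$ be a subgraph of the complete bipartite graph with parts $X$ and $Y$, where $|X|=m\ge 5$ and $|Y|=n\ge 8$. If some vertex $x\in X$ has $\deg_G(x)\ge 8$, then either $G$ contains a copy of $K_{2,2}$ or $\overline{G}$ contains a copy of $K_{4,4}$.
   Context: $\overline{G}$ denotes the bipartite complement of $G$, i.e. the graph on $X\cup Y$ whose edges are the edges $xy$ ($x\in X$, $y\in Y$) not in $G$. -}

module Defs where

open import Data.Nat using (ℕ; _≤_)
open import Data.Fin using (Fin)
open import Data.Bool using (Bool; true; false; not)
open import Data.Product using (Σ; _×_)
open import Data.Vec using (count)
open import Data.Vec using (tabulate)
open import Data.Bool.Properties using (T?)
open import Relation.Binary.PropositionalEquality using (_≡_)
open import Function.Definitions using (Injective)

-- A bipartite graph with parts X = Fin m and Y = Fin n, i.e. a subgraph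
-- of the complete bipartite graph K_{m,n} (on the same vertex set):
-- E x y = true iff xy is an edge.
BipGraph : ℕ → ℕ → Set
BipGraph m n = Fin m → Fin n → Bool

bipComplement : ∀ {m n} → BipGraph m n → BipGraph m n
bipComplement G x y = not (G x y)

degX : ∀ {m n} → BipGraph m n → Fin m → ℕ
degX G x = count (λ b → T? b) (tabulate (G x))

ContainsK : ∀ {m n} → ℕ → ℕ → BipGraph m n → Set
ContainsK {m} {n} s t G =
  Σ (Fin s → Fin m) λ f → Σ (Fin t → Fin n) λ g →
    Injective _≡_ _≡_ f × Injective _≡_ _≡_ g ×
    (∀ i j → G (f i) (g j) ≡ true)

-- Fix x with a + t neighbours y₁ … y_{a+t} and a further vertices x₁ … x_a of X.
-- If t of the yⱼ are adjacent to none of the xᵢ, these t vertices and the xᵢ span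
-- K_{a,t} in the complement.  Otherwise a + 1 of the yⱼ each have a neighbour
-- among the a vertices xᵢ, so by pigeonhole two of them share a neighbour xᵢ,
-- and together with x they span K_{2,2} in G.
module Submission where

open import Defs
open import Data.Nat using (ℕ; zero; suc; _+_; _≤_; _<_; _≤?_; s≤s)
open import Data.Nat.Properties using (+-suc; ≤-pred; ≤-refl; <-irrefl; +-mono-≤-<; ≰⇒>)
open import Data.Fin using (Fin; zero; suc; punchIn; inject≤)
open import Data.Fin.Properties using (suc-injective; punchIn-injective; punchInᵢ≢i; inject≤-injective; any?; pigeonhole; <⇒≢)
open import Data.Bool using (Bool; true; false; not)
open import Data.Bool.Properties using (T?; _≟_; ¬-not)
open import Data.Vec using (count; tabulate)
open import Data.Sum using (_⊎_; inj₁; inj₂)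
open import Data.Product using (Σ; ∃; _×_; _,_; proj₁; proj₂)
open import Data.Empty using (⊥-elim)
open import Function using (_∘_)
open import Function.Definitions using (Injective)
open import Relation.Nullary using (Dec; yes; no; does; ¬_)
open import Relation.Binary.PropositionalEquality using (_≡_; _≢_; refl; sym; cong; trans; subst)

countTrue : ∀ {n} → (Fin n → Bool) → ℕ
countTrue f = count (λ b → T? b) (tabulate f)

countTrue-+-countTrue-not : ∀ {n} (f : Fin n → Bool) →
  countTrue f + countTrue (not ∘ f) ≡ n
countTrue-+-countTrue-not {zero}  f = refl
countTrue-+-countTrue-not {suc n} f with f zero | countTrue-+-countTrue-not (f ∘ suc)
... | true  | eq = cong suc eq
... | false | eq = trans (+-suc _ _) (cong suc eq)

Selection : ∀ {n} → ℕ → (Fin n → Bool) → Set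
Selection {n} k f = Σ (Fin k → Fin n) λ g → Injective _≡_ _≡_ g × (∀ j → f (g j) ≡ true)

select : ∀ {n} (f : Fin n → Bool) k → k ≤ countTrue f → Selection k f
select f zero _ = (λ ()) , (λ { {()} }) , λ ()
select {suc n} f (suc k) k<c with f zero in f0
... | false = skip (select (f ∘ suc) (suc k) k<c)
  where
  skip : Selection (suc k) (f ∘ suc) → Selection (suc k) f
  skip (g , g-inj , g-true) = suc ∘ g , g-inj ∘ suc-injective , g-true
... | true = keep (select (f ∘ suc) k (≤-pred k<c))
  where
  keep : Selection k (f ∘ suc) → Selection (suc k) f
  keep (g , g-inj , g-true) = h , h-inj , h-true
    where
    h : Fin (suc k) → Fin (suc n)
    h zero    = zero
    h (suc j) = suc (g j)
    h-inj : Injective _≡_ _≡_ h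
    h-inj {zero}  {zero}  _  = refl
    h-inj {suc i} {suc j} eq = cong suc (g-inj (suc-injective eq))
    h-true : ∀ j → f (h j) ≡ true
    h-true zero    = f0
    h-true (suc j) = g-true j

injection-avoiding : ∀ {m} a (x : Fin (suc m)) → a ≤ m →
  Σ (Fin a → Fin (suc m)) λ f → Injective _≡_ _≡_ f × (∀ i → f i ≢ x)
injection-avoiding a x a≤m =
    (λ i → punchIn x (inject≤ i a≤m))
  , (λ {i} {j} eq → inject≤-injective a≤m a≤m i j (punchIn-injective x _ _ eq))
  , (λ i → punchInᵢ≢i x _)

does-true : ∀ {p} {P : Set p} (d : Dec P) → does d ≡ true → P
does-true (yes p) _ = p

not-does-true : ∀ {p} {P : Set p} (d : Dec P) → not (does d) ≡ true → ¬ P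
not-does-true (no ¬p) _ = ¬p

<-of-+-≡ : ∀ a t c d → c + d ≡ a + t → d < t → a < c
<-of-+-≡ a t c d eq d<t with c ≤? a
... | yes c≤a = ⊥-elim (<-irrefl eq (+-mono-≤-< c≤a d<t))
... | no  c≰a = ≰⇒> c≰a

containsK22 : ∀ {m n} (G : BipGraph m n) {x x′ : Fin m} {y y′ : Fin n} →
  x ≢ x′ → y ≢ y′ →
  G x y ≡ true → G x y′ ≡ true → G x′ y ≡ true → G x′ y′ ≡ true →
  ContainsK 2 2 G
containsK22 G {x} {x′} {y} {y′} x≢x′ y≢y′ exy exy′ ex′y ex′y′ =
  pair x x′ , pair y y′ , pair-injective x≢x′ , pair-injective y≢y′ , edges
  where
  pair : ∀ {k} → Fin k → Fin k → Fin 2 → Fin k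
  pair u v zero    = u
  pair u v (suc _) = v
  pair-injective : ∀ {k} {u v : Fin k} → u ≢ v → Injective _≡_ _≡_ (pair u v)
  pair-injective u≢v {zero}       {zero}       _  = refl
  pair-injective u≢v {zero}       {suc zero}   eq = ⊥-elim (u≢v eq)
  pair-injective u≢v {suc zero}   {zero}       eq = ⊥-elim (u≢v (sym eq))
  pair-injective u≢v {suc zero}   {suc zero}   _  = refl
  edges : ∀ i j → G (pair x x′ i) (pair y y′ j) ≡ true
  edges zero       zero       = exy
  edges zero       (suc zero) = exy′
  edges (suc zero) zero       = ex′y
  edges (suc zero) (suc zero) = ex′y′

sharedNeighbour : ∀ {a m n} (G : BipGraph m n) (xs : Fin a → Fin m) (ys : Fin (suc a) → Fin n) →
  (∀ k → ∃ λ i → G (xs i) (ys k) ≡ true) →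
  ∃ λ k → ∃ λ k′ → k ≢ k′ × ∃ λ i → G (xs i) (ys k) ≡ true × G (xs i) (ys k′) ≡ true
sharedNeighbour G xs ys adjacent
  with k , k′ , k<k′ , same ← pigeonhole ≤-refl (proj₁ ∘ adjacent) =
  k , k′ , <⇒≢ k<k′ , proj₁ (adjacent k) , proj₂ (adjacent k)
  , subst (λ i → G (xs i) (ys k′) ≡ true) (sym same) (proj₂ (adjacent k′))

K22-or-complement-Kat : ∀ {m n} a t → a ≤ m → (G : BipGraph (suc m) n) →
  Σ (Fin (suc m)) (λ x → a + t ≤ degX G x) →
  ContainsK 2 2 G ⊎ ContainsK a t (bipComplement G)
K22-or-complement-Kat a t a≤m G (x , deg≥) with injection-avoiding a x a≤m | select (G x) (a + t) deg≥
... | xs , xs-inj , xs≢x | ys , ys-inj , x~ys = case (t ≤? countTrue isolated)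
  where
  hasNeighbour : ∀ j → Dec (∃ λ i → G (xs i) (ys j) ≡ true)
  hasNeighbour j = any? (λ i → G (xs i) (ys j) ≟ true)

  isolated : Fin (a + t) → Bool
  isolated j = not (does (hasNeighbour j))

  case : Dec (t ≤ countTrue isolated) → ContainsK 2 2 G ⊎ ContainsK a t (bipComplement G)
  case (yes t≤c) with select isolated t t≤c
  ... | zs , zs-inj , zs-isolated =
    inj₂ (xs , ys ∘ zs , xs-inj , zs-inj ∘ ys-inj , λ i j →
      sym (¬-not λ e → not-does-true (hasNeighbour (zs j)) (zs-isolated j) (i , sym e)))
  case (no t≰c) with select (does ∘ hasNeighbour) (suc a) (<-of-+-≡ a t _ _
                        (countTrue-+-countTrue-not (does ∘ hasNeighbour)) (≰⇒> t≰c))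
  ... | ws , ws-inj , ws-adjacent
    with k , k′ , k≢k′ , i , e , e′ ← sharedNeighbour G xs (ys ∘ ws)
           (λ k → does-true (hasNeighbour (ws k)) (ws-adjacent k)) =
    inj₁ (containsK22 G (xs≢x i ∘ sym) (k≢k′ ∘ ws-inj ∘ ys-inj)
            (x~ys (ws k)) (x~ys (ws k′)) e e′)

lemma2 : (m n : ℕ) → 5 ≤ m → 8 ≤ n → (G : BipGraph m n) →
    Σ (Fin m) (λ x → 8 ≤ degX G x) →
    ContainsK 2 2 G ⊎ ContainsK 4 4 (bipComplement G)
lemma2 (suc m) n (s≤s 4≤m) _ G x = K22-or-complement-Kat 4 4 4≤m G x
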